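{- Let $A$ be a circular $m\times n$ matrix without dominating rows and $\alpha\in\mathbb{N}$. Let $\Gamma$ be a circuit in $F(A)$ with $s$ row arcs and winding number $p$, such that $p$ does not divide $\alpha s$ and $2\le p\le\alpha s-1$. Let $r:=\alpha s-p\lfloor\alpha s/p\rfloor$. Then the $\Gamma$-inequality of $Q^*(A,\alpha\mathbf 1)$ has the form $$r\sum_{j\notin\otimes(\Gamma)}x_j+(r+1)\sum_{j\in\otimes(\Gamma)}x_j\ \ge\ r\left\lceil\frac{\alpha s}{p}\right\rceil.$$ Moreover, if $\alpha=1$ and $\otimes(\Gamma)\ne\emptyset$, this inequality is the row family inequality induced by $F:=\{i\in[m]: a_i \text{ is a row arc of }\Gamma\}$.
   Context: $[n]=\{1,\dots,n\}$ with addition mod $n$ (node $0$ identified with $n$); $[a,c)_n$ denotes the cyclic interval $\{a,\dots,c-1\}$ mod $n$. A $\{0,1\}$ $m\times n$ matrix $A$ (entries $a_{ij}$) is circular if each row $i$ is the incidence vector of $[\ell_i,\ell_i+k_i)_n$, $\ell_i,k_i\in[n]$, $2\le k_i\le n-1$. Row $i$ dominates row $\ell\ne i$ if $a_{ij}\ge a_{\ell j}$ for all $j$. $Q(A,b)=\{x\ge0:Ax\ge b\}$, $Q^*(A,b)=\mathrm{conv}(Q(A,b)\cap\mathbb{Z}^n)$. $F(A)$ is the digraph on $[n]$ with row arcs $a_i=(\ell_i-1,\ell_i+k_i-1)$ (length $k_i$), forward short arcs $(j-1,j)$ (length 1) and reverse short arcs $(j,j-1)$ (length $-1$). Circuit =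 simple directed circuit; winding number $p$ given by $pn=$ sum of arc lengths. $\otimes(\Gamma)=\{j:(j,j-1)\in E(\Gamma)\}$. For a circuit $\Gamma$ with $s$ row arcs, winding number $p\neq 0$, and $b=\alpha\mathbf1$: $t=\alpha s$, $\beta=\lfloor t/p\rfloor$, $r=t-\beta p$, and the $\Gamma$-inequality is $\sum_{j\in[n]}(p^-_j+r)x_j\ge r(\beta+1)$, where $p^-_j$ is the number of reverse arcs of $\Gamma$ "jumping over" $j$ (the reverse short arc $(j,j-1)$ jumps over $j$ only). Row family inequality: for $F\subset[m]$, $s=|F|\ge2$, $p\in\{1,\dots,s-1\}$ with $p\nmid s$, $r=s-p\lfloor s/p\rfloor$, $I(F,p)=\{j:\sum_{i\in F}a_{ij}\le p\}$, $O(F,p)=\{j:\sum_{i\in F}a_{ij}=p+1\}$, the rfi induced by $(F,p)$ is $(r+1)\sum_{j\in O(F,p)}x_j+r\sum_{j\in I(F,p)}x_j\ge r\lceil s/p\rceil$; the rfi induced by $F$ is the one with $p=\max_j\sum_{i\in F}a_{ij}-1$. -}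

module Defs where

open import Data.Nat using (ℕ; zero; suc; _+_; _*_; _∸_; _≤_; _⊔_; _<ᵇ_; _≡ᵇ_; _≤ᵇ_; NonZero)
open import Data.Nat.DivMod using (_/_; _%_)
open import Data.Nat.Divisibility using (_∣_; _∣?_)
open import Data.Integer as ℤ using (ℤ; +_; -[1+_])
open import Data.Fin as Fin using (Fin; toℕ)
open import Data.Fin.Properties using (any?)
open import Data.Bool using (Bool; true; false; if_then_else_)
open import Data.Product using (Σ; ∃; _×_; _,_)
open import Relation.Nullary using (¬_; Dec; yes; no)
open import Relation.Nullary.Decidable using (⌊_⌋)
open import Relation.Binary.PropositionalEquality using (_≡_; _≢_; refl; cong)

sumFin : ∀ {k} → (Fin k → ℕ) → ℕ
sumFin {zero}  f = 0
sumFin {suc k} f = f Fin.zero + sumFin (λ i → f (Fin.suc i))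

sumFinℤ : ∀ {k} → (Fin k → ℤ) → ℤ
sumFinℤ {zero}  f = + 0
sumFinℤ {suc k} f = f Fin.zero ℤ.+ sumFinℤ (λ i → f (Fin.suc i))

maxFin : ∀ {k} → (Fin k → ℕ) → ℕ
maxFin {zero}  f = 0
maxFin {suc k} f = f Fin.zero ⊔ maxFin (λ i → f (Fin.suc i))

ceilDiv : (a p : ℕ) → {{NonZero p}} → ℕ
ceilDiv a p = if ⌊ p ∣? a ⌋ then a / p else suc (a / p)

-- Elements of [n] = {1,…,n} are represented by Fin n via j ↦ j mod n
-- (index 0 stands for the node/column n).
-- A circular m×n matrix is given by the data (ℓ_i, k_i); row i is the
-- incidence vector of the cyclic interval [ℓ_i, ℓ_i + k_i)_n.
record Circular (m n : ℕ) : Set where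
  field
    ℓ     : Fin m → Fin n
    k     : Fin m → ℕ
    k≥2   : ∀ i → 2 ≤ k i
    k≤n-1 : ∀ i → k i ≤ n ∸ 1

-- an inequality  Σ_j coef_j x_j ≥ rhs  on x ∈ ℝⁿ
record Ineq (n : ℕ) : Set where
  constructor ineq
  field
    coef : Fin n → ℕ
    rhs  : ℕ

SameIneq : ∀ {n} → Ineq n → Ineq n → Set
SameIneq I J = (∀ j → Ineq.coef I j ≡ Ineq.coef J j) × (Ineq.rhs I ≡ Ineq.rhs J)

module Setup (m n : ℕ) {{nz : NonZero n}} (A : Circular m n) where
  open Circular A

  -- entry a_ij : j ∈ [ℓ_i, ℓ_i + k_i)_n  iff  (j - ℓ_i) mod n < k_i
  entry : Fin m → Fin n → ℕ
  entry i j = if ((toℕ j + n ∸ toℕ (ℓ i)) % n) <ᵇ k i then 1 else 0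

  Dominates : Fin m → Fin m → Set
  Dominates i l = ∀ j → entry l j ≤ entry i j

  NoDominatingRows : Set
  NoDominatingRows = ∀ i l → i ≢ l → ¬ Dominates i l

  -- the digraph F(A); nodes are residues mod n (values in {0,…,n-1})
  data Arc : Set where
    rowArc : Fin m → Arc     -- a_i = (ℓ_i - 1, ℓ_i + k_i - 1)
    fwd    : Fin n → Arc     -- (j - 1, j)
    rev    : Fin n → Arc     -- (j, j - 1)

  pred′ : ℕ → ℕ
  pred′ x = (x + n ∸ 1) % n

  tail : Arc → ℕ
  tail (rowArc i) = pred′ (toℕ (ℓ i))
  tail (fwd j)    = pred′ (toℕ j)
  tail (rev j)    = toℕ j % n

  head : Arc → ℕ
  head (rowArc i) = pred′ (toℕ (ℓ i) + k i)
  head (fwd j)    = toℕ j % n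
  head (rev j)    = pred′ (toℕ j)

  arcLength : Arc → ℤ
  arcLength (rowArc i) = + k i
  arcLength (fwd j)    = + 1
  arcLength (rev j)    = -[1+ 0 ]

  _≟A_ : (a b : Arc) → Dec (a ≡ b)
  rowArc i ≟A rowArc i′ with i Fin.≟ i′
  ... | yes refl = yes refl
  ... | no ne    = no λ { refl → ne refl }
  fwd j ≟A fwd j′ with j Fin.≟ j′
  ... | yes refl = yes refl
  ... | no ne    = no λ { refl → ne refl }
  rev j ≟A rev j′ with j Fin.≟ j′
  ... | yes refl = yes refl
  ... | no ne    = no λ { refl → ne refl }
  rowArc _ ≟A fwd _    = no λ ()
  rowArc _ ≟A rev _    = no λ ()
  fwd _    ≟A rowArc _ = no λ ()
  fwd _    ≟A rev _    = no λ ()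
  rev _    ≟A rowArc _ = no λ ()
  rev _    ≟A fwd _    = no λ ()

  record Circuit : Set where
    field
      size    : ℕ
      arc     : Fin (suc size) → Arc
      closed  : ∀ t u → toℕ u ≡ suc (toℕ t) % suc size → head (arc t) ≡ tail (arc u)
      simple  : ∀ t u → tail (arc t) ≡ tail (arc u) → t ≡ u

  module _ (Γ : Circuit) where
    open Circuit Γ

    isRowArc : Arc → ℕ
    isRowArc (rowArc _) = 1
    isRowArc (fwd _)    = 0
    isRowArc (rev _)    = 0

    rowArcCount : ℕ
    rowArcCount = sumFin (λ t → isRowArc (arc t))

    HasWinding : ℤ → Set
    HasWinding p = sumFinℤ (λ t → arcLength (arc t)) ≡ p ℤ.* + n

    Otimes : Fin n → Set
    Otimes j = ∃ λ t → arc t ≡ rev j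

    -- p⁻_j : number of reverse arcs of Γ jumping over j (only (j,j-1) does)
    pMinus : Fin n → ℕ
    pMinus j = sumFin (λ t → if ⌊ arc t ≟A rev j ⌋ then 1 else 0)

    ΓIneq : (α p : ℕ) → {{NonZero p}} → Ineq n
    ΓIneq α p = ineq (λ j → pMinus j + r) (r * suc β)
      where
        t′ = α * rowArcCount
        β  = t′ / p
        r  = t′ ∸ β * p

    rowsOf : Fin m → Bool
    rowsOf i = ⌊ any? (λ t → arc t ≟A rowArc i) ⌋

  module _ (F : Fin m → Bool) where
    card : ℕ
    card = sumFin (λ i → if F i then 1 else 0)

    colSum : Fin n → ℕ
    colSum j = sumFin (λ i → if F i then entry i j else 0)

    ValidRFI : ℕ → Set
    ValidRFI p = 2 ≤ card × 1 ≤ p × p ≤ card ∸ 1 × ¬ (p ∣ card)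

    rfi : (p : ℕ) → {{NonZero p}} → Ineq n
    rfi p = ineq (λ j → if colSum j ≡ᵇ suc p then suc r
                        else if colSum j ≤ᵇ p then r else 0)
                 (r * ceilDiv card p)
      where r = card ∸ p * (card / p)

    pInduced : ℕ
    pInduced = maxFin colSum ∸ 1

-- Walk once around Γ and follow, for a fixed column j, the forward distance ψ from j to
-- the current node. An arc of length L changes ψ by L, minus n each time it passes over j:
-- a row arc a_i passes over j iff a_ij = 1, the short arc (j−1, j) passes over j once, and
-- the reverse arc (j, j−1) passes over it backwards. Closing the walk, the total change is 0
-- while the total length is pn, so for every column
--     p + [(j, j−1) ∈ Γ] = Σ_{i∈F} a_ij + [(j−1, j) ∈ Γ].
-- Simplicity of Γ makes p⁻_j the indicator of j ∈ ⊗(Γ), which gives the Γ-inequality.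
-- If both short arcs at j lie on Γ, then Γ is the 2-cycle they form, whose winding number
-- is 0, not p; hence the column sums of F are p + 1 on ⊗(Γ) and at most p elsewhere, so for
-- α = 1 and ⊗(Γ) ≠ ∅ the rfi induced by F has parameter p and coincides with the Γ-inequality.

module Submission where

open import Defs
open import Data.Nat using (ℕ; suc; _*_; _∸_; _≤_; NonZero)
open import Data.Nat.DivMod using (_/_)
open import Data.Nat.Divisibility using (_∣_)
open import Data.Integer using (+_)
open import Data.Fin using (Fin)
open import Data.Product using (Σ; ∃; _×_)
open import Relation.Nullary using (¬_)
open import Relation.Binary.PropositionalEquality using (_≡_)

open import Data.Nat
open import Data.Nat.Properties
open import Data.Nat.DivMod
open import Data.Nat.Divisibility using (_∣?_)
open import Data.Nat.Tactic.RingSolver using (solve-∀)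
open import Data.Bool using (Bool; true; false; if_then_else_; T)
open import Data.Empty using (⊥-elim)
open import Data.Fin.Patterns using (0F; 1F)
open import Data.Fin as Fin using (toℕ; fromℕ<; inject₁; fromℕ; punchIn)
open import Data.Fin.Properties using (toℕ<n; toℕ-injective; toℕ-fromℕ<; toℕ-inject₁; toℕ-fromℕ; punchInᵢ≢i; any?)
open import Data.Integer as ℤ using (ℤ)
import Data.Integer.Properties as ℤP
open import Data.Product using (_,_; proj₁; proj₂)
open import Data.Sum using (_⊎_; inj₁; inj₂)
open import Function using (_∘_)
open import Relation.Nullary using (Dec; yes; no; contradiction)
open import Relation.Nullary.Decidable using (⌊_⌋; isYes≗does; dec-true; dec-false)
open import Relation.Unary using (Pred; Decidable)
open import Relation.Binary.PropositionalEquality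
import Algebra.Properties.Semiring.Sum
open import Algebra.Properties.Semiring.Sum +-*-semiring
  using (sum; sum-cong-≗; sum-replicate-zero; sum-remove; sum-init-last; ∑-distrib-+; ∑-comm; *-distribʳ-sum)
module ℤΣ = Algebra.Properties.Semiring.Sum ℤP.+-*-semiring

⌊⌋-yes : ∀ {p} {P : Set p} (P? : Dec P) → P → ⌊ P? ⌋ ≡ true
⌊⌋-yes P? p = trans (isYes≗does P?) (dec-true P? p)

⌊⌋-no : ∀ {p} {P : Set p} (P? : Dec P) → ¬ P → ⌊ P? ⌋ ≡ false
⌊⌋-no P? ¬p = trans (isYes≗does P?) (dec-false P? ¬p)

if-T : ∀ {a} {A : Set a} {b} {x y : A} → T b → (if b then x else y) ≡ x
if-T {b = true} _ = refl

if-¬T : ∀ {a} {A : Set a} {b} {x y : A} → ¬ T b → (if b then x else y) ≡ y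
if-¬T {b = false} _  = refl
if-¬T {b = true}  ¬t = contradiction _ ¬t

sumFin≡sum : ∀ {k} (f : Fin k → ℕ) → sumFin f ≡ sum f
sumFin≡sum {zero}  f = refl
sumFin≡sum {suc k} f = cong (λ s → f 0F + s) (sumFin≡sum (f ∘ Fin.suc))

sumFinℤ≡sum : ∀ {k} (f : Fin k → ℤ) → sumFinℤ f ≡ ℤΣ.sum f
sumFinℤ≡sum {zero}  f = refl
sumFinℤ≡sum {suc k} f = cong (λ s → f 0F ℤ.+ s) (sumFinℤ≡sum (f ∘ Fin.suc))

pos-sum : ∀ {k} (f : Fin k → ℕ) → + sum f ≡ ℤΣ.sum (λ i → + f i)
pos-sum {zero}  f = refl
pos-sum {suc k} f = trans (ℤP.pos-+ (f 0F) (sum (f ∘ Fin.suc))) (cong (λ s → + f 0F ℤ.+ s) (pos-sum (f ∘ Fin.suc)))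

sum-zero : ∀ {k} (f : Fin k → ℕ) → (∀ i → f i ≡ 0) → sum f ≡ 0
sum-zero {k} _ f≡0 = trans (sum-cong-≗ f≡0) (sum-replicate-zero k)

sum-single : ∀ {k} (f : Fin k → ℕ) i₀ → (∀ i → i ≢ i₀ → f i ≡ 0) → sum f ≡ f i₀
sum-single {suc k} f i₀ f≡0 = begin
  sum f                                 ≡⟨ sum-remove {i = i₀} f ⟩
  f i₀ + sum (λ i → f (punchIn i₀ i))   ≡⟨ cong (λ s → f i₀ + s) (sum-zero _ λ i → f≡0 _ (punchInᵢ≢i i₀ i)) ⟩
  f i₀ + 0                              ≡⟨ +-identityʳ (f i₀) ⟩
  f i₀                                  ∎
  where open ≡-Reasoning

sum-pair : ∀ {k} → k ≡ 2 → (f : Fin k → ℕ) {t u : Fin k} → t ≢ u → sum f ≡ f t + f u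
sum-pair refl f {0F} {0F} t≢u = contradiction refl t≢u
sum-pair refl f {0F} {1F} _   = cong (λ s → f 0F + s) (+-identityʳ (f 1F))
sum-pair refl f {1F} {0F} _   = trans (cong (λ s → f 0F + s) (+-identityʳ (f 1F))) (+-comm (f 0F) (f 1F))
sum-pair refl f {1F} {1F} t≢u = contradiction refl t≢u

module _ {k p} {P : Pred (Fin k) p} (P? : Decidable P) (P-unique : ∀ {t u} → P t → P u → t ≡ u) where

  sum-if-unique : ∀ (g : Fin k → ℕ) {t₀} → P t₀ → sum (λ t → if ⌊ P? t ⌋ then g t else 0) ≡ g t₀
  sum-if-unique g {t₀} pt₀ =
    trans (sum-single (λ t → if ⌊ P? t ⌋ then g t else 0) t₀ λ t t≢t₀ →
             cong (if_then g t else 0) (⌊⌋-no (P? t) (λ pt → t≢t₀ (P-unique pt pt₀))))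
          (cong (if_then g t₀ else 0) (⌊⌋-yes (P? t₀) pt₀))

  sum-if-none : ∀ (g : Fin k → ℕ) → ¬ ∃ P → sum (λ t → if ⌊ P? t ⌋ then g t else 0) ≡ 0
  sum-if-none g ¬∃P = sum-zero _ λ t → cong (if_then g t else 0) (⌊⌋-no (P? t) (λ pt → ¬∃P (t , pt)))

  sum-if-any : ∀ x → sum (λ t → if ⌊ P? t ⌋ then x else 0) ≡ (if ⌊ any? P? ⌋ then x else 0)
  sum-if-any x with any? P?
  ... | yes (t₀ , pt₀) = sum-if-unique (λ _ → x) pt₀
  ... | no ¬∃P         = sum-if-none (λ _ → x) ¬∃P

maxFin-upper : ∀ {k} (f : Fin k → ℕ) i → f i ≤ maxFin f
maxFin-upper f 0F          = m≤m⊔n _ _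
maxFin-upper f (Fin.suc i) = ≤-trans (maxFin-upper (f ∘ Fin.suc) i) (m≤n⊔m _ _)

maxFin-least : ∀ {k} (f : Fin k → ℕ) {b} → (∀ i → f i ≤ b) → maxFin f ≤ b
maxFin-least {zero}  f f≤b = z≤n
maxFin-least {suc k} f f≤b = ⊔-lub (f≤b 0F) (maxFin-least (f ∘ Fin.suc) (f≤b ∘ Fin.suc))

maxFin-attained : ∀ {k} (f : Fin k → ℕ) {b} i → f i ≡ b → (∀ i → f i ≤ b) → maxFin f ≡ b
maxFin-attained f i fi≡b f≤b = ≤-antisym (maxFin-least f f≤b) (subst (_≤ maxFin f) fi≡b (maxFin-upper f i))

module _ {n : ℕ} .{{_ : NonZero n}} where

  [m%n+k]%n≡[m+k]%n : ∀ m k → (m % n + k) % n ≡ (m + k) % n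
  [m%n+k]%n≡[m+k]%n m k = begin
    (m % n + k) % n          ≡⟨ %-distribˡ-+ (m % n) k n ⟩
    (m % n % n + k % n) % n  ≡⟨ cong (λ x → (x + k % n) % n) (m%n%n≡m%n m n) ⟩
    (m % n + k % n) % n      ≡⟨ %-distribˡ-+ m k n ⟨
    (m + k) % n              ∎
    where open ≡-Reasoning

  [k+m%n]%n≡[k+m]%n : ∀ k m → (k + m % n) % n ≡ (k + m) % n
  [k+m%n]%n≡[k+m]%n k m = begin
    (k + m % n) % n  ≡⟨ cong (_% n) (+-comm k (m % n)) ⟩
    (m % n + k) % n  ≡⟨ [m%n+k]%n≡[m+k]%n m k ⟩
    (m + k) % n      ≡⟨ cong (_% n) (+-comm m k) ⟩
    (k + m) % n      ∎
    where open ≡-Reasoning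

  m%n+n≡m : ∀ x → n ≤ x → x < n + n → x % n + n ≡ x
  m%n+n≡m x n≤x x<2n = begin
    x % n + n            ≡⟨ cong (λ y → x % n + y) (+-identityʳ n) ⟨
    x % n + 1 * n        ≡⟨ cong (λ q → x % n + q * n) x/n≡1 ⟨
    x % n + (x / n) * n  ≡⟨ m≡m%n+[m/n]*n x n ⟨
    x                    ∎
    where
    open ≡-Reasoning
    x/n≡1 : x / n ≡ 1
    x/n≡1 = trans (m/n≡1+[m∸n]/n n≤x) (cong suc (m<n⇒m/n≡0 (m<n+o⇒m∸n<o x n x<2n)))

  suc[a+b]%n≡0⇒suc[a+b]≡n : ∀ a b → a < n → b < n → suc (a + b) % n ≡ 0 → suc (a + b) ≡ n
  suc[a+b]%n≡0⇒suc[a+b]≡n a b a<n b<n x%n≡0 = multiple (x / n) (trans (m≡m%n+[m/n]*n x n) (cong (_+ x / n * n) x%n≡0))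
    where
    x = suc (a + b)
    multiple : ∀ q → x ≡ q * n → x ≡ n
    multiple zero          ()
    multiple (suc zero)    x≡n = trans x≡n (+-identityʳ n)
    multiple (suc (suc q)) x≡ = ⊥-elim (<⇒≱ (+-mono-≤-< a<n b<n) (begin
      n + n            ≤⟨ +-monoʳ-≤ n (m≤m+n n (q * n)) ⟩
      n + (n + q * n)  ≡⟨ x≡ ⟨
      x                ∎))
      where open ≤-Reasoning

  carry : ∀ e u k → suc (e + u) ≡ n → k ≤ n →
          k + u ≡ (if e <ᵇ k then 1 else 0) * n + (u + k) % n
  carry e u k gap k≤n with e <ᵇ k in e<ᵇk
  ... | true = begin
    k + u              ≡⟨ +-comm k u ⟩
    u + k              ≡⟨ m%n+n≡m (u + k) n≤u+k (+-mono-<-≤ u<n k≤n) ⟨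
    (u + k) % n + n    ≡⟨ +-comm _ n ⟩
    n + (u + k) % n    ≡⟨ cong (_+ (u + k) % n) (+-identityʳ n) ⟨
    1 * n + (u + k) % n ∎
    where
    open ≡-Reasoning
    u<n : u < n
    u<n = subst (u <_) gap (s≤s (m≤n+m u e))
    n≤u+k : n ≤ u + k
    n≤u+k = subst₂ _≤_ gap (+-comm k u) (+-monoˡ-≤ u (<ᵇ⇒< e k (subst T (sym e<ᵇk) _)))
  ... | false = begin
    k + u        ≡⟨ +-comm k u ⟩
    u + k        ≡⟨ m<n⇒m%n≡m u+k<n ⟨
    (u + k) % n  ∎
    where
    open ≡-Reasoning
    u+k<n : u + k < n
    u+k<n = subst (u + k <_) gap (s≤s (subst (u + k ≤_) (+-comm u e)
              (+-monoʳ-≤ u (≮⇒≥ λ e<k → subst T e<ᵇk (<⇒<ᵇ e<k)))))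

cancel-common : ∀ {n} a b c L X → a * n + (b * n + L + X) ≡ L + (c * n + X) → (b + a) * n ≡ c * n
cancel-common {n} a b c L X eq = +-cancelʳ-≡ (L + X) ((b + a) * n) (c * n)
  (trans (regroupˡ a b L X n) (trans eq (regroupʳ c L X n)))
  where
  regroupˡ : ∀ a b L X n → (b + a) * n + (L + X) ≡ a * n + (b * n + L + X)
  regroupˡ = solve-∀
  regroupʳ : ∀ c L X n → L + (c * n + X) ≡ c * n + (L + X)
  regroupʳ = solve-∀

ceilDiv-∤ : ∀ a p .{{_ : NonZero p}} → ¬ p ∣ a → ceilDiv a p ≡ suc (a / p)
ceilDiv-∤ a p p∤a = cong (if_then a / p else suc (a / p)) (⌊⌋-no (p ∣? a) p∤a)

suc-%-cases : ∀ {a b S} .{{_ : NonZero S}} → a < S → b ≡ suc a % S → b ≡ suc a ⊎ (b ≡ 0 × suc a ≡ S)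
suc-%-cases {a} {b} {S} a<S b≡ with suc a <? S
... | yes 1+a<S = inj₁ (trans b≡ (m<n⇒m%n≡m 1+a<S))
... | no  1+a≮S = inj₂ (trans b≡ (trans (cong (_% S) 1+a≡S) (n%n≡0 S)) , 1+a≡S)
  where 1+a≡S = ≤-antisym a<S (≮⇒≥ 1+a≮S)

successor-swap⇒2 : ∀ {a b S} .{{_ : NonZero S}} → a < S → b < S →
  b ≡ suc a % S → a ≡ suc b % S → a ≢ b → S ≡ 2
successor-swap⇒2 a<S b<S b≡ a≡ a≢b with suc-%-cases a<S b≡ | suc-%-cases b<S a≡
... | inj₁ refl              | inj₁ ()
... | inj₁ refl              | inj₂ (refl , 2≡S) = sym 2≡S
... | inj₂ (refl , 1+a≡S)    | inj₁ refl       = sym 1+a≡S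
... | inj₂ (refl , _)        | inj₂ (refl , _) = contradiction refl a≢b

-- ψ measures the forward distance from column j; it turns the cyclic interval condition
-- "j ∈ [ℓ, ℓ + k)" into a carry past n.
module Rotation (n : ℕ) .{{_ : NonZero n}} (j : ℕ) (j<n : j < n) where

  ψ : ℕ → ℕ
  ψ x = (x + (n ∸ j)) % n

  ψ-pred : ∀ x → ψ ((x + n ∸ 1) % n) ≡ (x + pred n + (n ∸ j)) % n
  ψ-pred x = begin
    ((x + n ∸ 1) % n + (n ∸ j)) % n  ≡⟨ [m%n+k]%n≡[m+k]%n (x + n ∸ 1) (n ∸ j) ⟩
    (x + n ∸ 1 + (n ∸ j)) % n        ≡⟨ cong (λ y → (y + (n ∸ j)) % n) (+-∸-assoc x (>-nonZero⁻¹ n)) ⟩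
    (x + pred n + (n ∸ j)) % n       ∎
    where open ≡-Reasoning

  ψ-pred-+ : ∀ x k → ψ ((x + k + n ∸ 1) % n) ≡ (ψ ((x + n ∸ 1) % n) + k) % n
  ψ-pred-+ x k = begin
    ψ ((x + k + n ∸ 1) % n)                ≡⟨ ψ-pred (x + k) ⟩
    (x + k + pred n + (n ∸ j)) % n         ≡⟨ cong (_% n) (rearrange x k (pred n) (n ∸ j)) ⟩
    (x + pred n + (n ∸ j) + k) % n         ≡⟨ [m%n+k]%n≡[m+k]%n _ k ⟨
    ((x + pred n + (n ∸ j)) % n + k) % n   ≡⟨ cong (λ y → (y + k) % n) (ψ-pred x) ⟨
    (ψ ((x + n ∸ 1) % n) + k) % n          ∎
    where
    open ≡-Reasoning
    rearrange : ∀ x k N c → x + k + N + c ≡ x + N + c + k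
    rearrange = solve-∀

  distance-gap : ∀ ℓ → ℓ < n → suc ((j + n ∸ ℓ) % n + ψ ((ℓ + n ∸ 1) % n)) ≡ n
  distance-gap ℓ ℓ<n = suc[a+b]%n≡0⇒suc[a+b]≡n _ _ (m%n<n _ n) (m%n<n _ n) (begin
    (suc e + ψ ((ℓ + n ∸ 1) % n)) % n    ≡⟨ cong (λ y → (suc e + y) % n) (ψ-pred ℓ) ⟩
    (suc e + (ℓ + N + c) % n) % n        ≡⟨ [k+m%n]%n≡[k+m]%n (suc e) (ℓ + N + c) ⟩
    (suc e + (ℓ + N + c)) % n            ≡⟨ cong (_% n) (+-suc e (ℓ + N + c)) ⟨
    (e + suc (ℓ + N + c)) % n            ≡⟨ [m%n+k]%n≡[m+k]%n (j + n ∸ ℓ) (suc (ℓ + N + c)) ⟩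
    (j + n ∸ ℓ + suc (ℓ + N + c)) % n    ≡⟨ cong (_% n) sum≡3n ⟩
    (n + n + n) % n                      ≡⟨ [m+n]%n≡m%n (n + n) n ⟩
    (n + n) % n                          ≡⟨ [m+n]%n≡m%n n n ⟩
    n % n                                ≡⟨ n%n≡0 n ⟩
    0                                    ∎)
    where
    open ≡-Reasoning
    N = pred n
    c = n ∸ j
    e = (j + n ∸ ℓ) % n
    regroup : ∀ d ℓ N c → d + suc (ℓ + N + c) ≡ d + ℓ + suc N + c
    regroup = solve-∀
    regroup′ : ∀ j n c → j + n + n + c ≡ j + c + n + n
    regroup′ = solve-∀
    ℓ≤j+n : ℓ ≤ j + n
    ℓ≤j+n = ≤-trans (<⇒≤ ℓ<n) (m≤n+m n j)
    sum≡3n : j + n ∸ ℓ + suc (ℓ + N + c) ≡ n + n + n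
    sum≡3n = begin
      j + n ∸ ℓ + suc (ℓ + N + c)   ≡⟨ regroup (j + n ∸ ℓ) ℓ N c ⟩
      j + n ∸ ℓ + ℓ + suc N + c     ≡⟨ cong₂ (λ a b → a + b + c) (m∸n+n≡m ℓ≤j+n) (suc-pred n) ⟩
      j + n + n + c                 ≡⟨ regroup′ j n c ⟩
      j + c + n + n                 ≡⟨ cong (λ a → a + n + n) (m+[n∸m]≡n (<⇒≤ j<n)) ⟩
      n + n + n                     ∎

  interval-crossing : ∀ ℓ k → ℓ < n → k ≤ n →
    k + ψ ((ℓ + n ∸ 1) % n) ≡
    (if (j + n ∸ ℓ) % n <ᵇ k then 1 else 0) * n + ψ ((ℓ + k + n ∸ 1) % n)
  interval-crossing ℓ k ℓ<n k≤n =
    trans (carry _ _ k (distance-gap ℓ ℓ<n) k≤n) (cong (λ y → crossed * n + y) (sym (ψ-pred-+ ℓ k)))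
    where crossed = if (j + n ∸ ℓ) % n <ᵇ k then 1 else 0

  private
    pred-+1 : ∀ x → (x + 1 + n ∸ 1) % n ≡ x % n
    pred-+1 x = begin
      (x + 1 + n ∸ 1) % n  ≡⟨ cong (_% n) (+-∸-assoc (x + 1) (>-nonZero⁻¹ n)) ⟩
      (x + 1 + pred n) % n ≡⟨ cong (_% n) (trans (+-assoc x 1 (pred n)) (cong (λ y → x + y) (suc-pred n))) ⟩
      (x + n) % n          ≡⟨ [m+n]%n≡m%n x n ⟩
      x % n                ∎
      where open ≡-Reasoning

    [j+n∸x]%n≡0⇒x≡j : ∀ x → x < n → (j + n ∸ x) % n ≡ 0 → x ≡ j
    [j+n∸x]%n≡0⇒x≡j x x<n d≡0 = begin
      x                        ≡⟨ m<n⇒m%n≡m x<n ⟨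
      x % n                    ≡⟨ cong (λ y → (y + x) % n) d≡0 ⟨
      ((j + n ∸ x) % n + x) % n ≡⟨ [m%n+k]%n≡[m+k]%n (j + n ∸ x) x ⟩
      (j + n ∸ x + x) % n      ≡⟨ cong (_% n) (m∸n+n≡m (≤-trans (<⇒≤ x<n) (m≤n+m n j))) ⟩
      (j + n) % n              ≡⟨ [m+n]%n≡m%n j n ⟩
      j % n                    ≡⟨ m<n⇒m%n≡m j<n ⟩
      j                        ∎
      where open ≡-Reasoning

  unit-crossing-≡ : 1 + ψ ((j + n ∸ 1) % n) ≡ 1 * n + ψ (j % n)
  unit-crossing-≡ =
    trans (interval-crossing j 1 j<n (>-nonZero⁻¹ n)) (cong₂ (λ b y → b * n + ψ y) crossed (pred-+1 j))
    where
    crossed : (if (j + n ∸ j) % n <ᵇ 1 then 1 else 0) ≡ 1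
    crossed = cong (λ y → if y <ᵇ 1 then 1 else 0) (trans (cong (_% n) (m+n∸m≡n j n)) (n%n≡0 n))

  unit-crossing-≢ : ∀ x → x < n → x ≢ j → 1 + ψ ((x + n ∸ 1) % n) ≡ ψ (x % n)
  unit-crossing-≢ x x<n x≢j =
    trans (interval-crossing x 1 x<n (>-nonZero⁻¹ n)) (cong₂ (λ b y → b * n + ψ y) crossed (pred-+1 x))
    where
    crossed : (if (j + n ∸ x) % n <ᵇ 1 then 1 else 0) ≡ 0
    crossed with (j + n ∸ x) % n in d
    ... | zero  = ⊥-elim (x≢j ([j+n∸x]%n≡0⇒x≡j x x<n d))
    ... | suc _ = refl

module _ {m n : ℕ} {{_ : NonZero n}} (A : Circular m n) (F : Fin m → Bool) (q : ℕ) {{_ : NonZero q}} where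
  open Setup m n A

  rfi-coef-O : ∀ {j} → colSum F j ≡ suc q → Ineq.coef (rfi F q) j ≡ suc (card F ∸ q * (card F / q))
  rfi-coef-O {j} colSum≡ = if-T (≡⇒≡ᵇ (colSum F j) (suc q) colSum≡)

  rfi-coef-I : ∀ {j} → colSum F j ≤ q → Ineq.coef (rfi F q) j ≡ card F ∸ q * (card F / q)
  rfi-coef-I {j} colSum≤ =
    trans (if-¬T λ eq → <-irrefl (≡ᵇ⇒≡ (colSum F j) (suc q) eq) (s≤s colSum≤)) (if-T (≤⇒≤ᵇ colSum≤))

module CircuitBalance {m n : ℕ} {{_ : NonZero n}} {A : Circular m n} (Γ : Setup.Circuit m n A) where
  open Setup m n A
  open Circuit Γ

  arc-injective : ∀ {t u} → arc t ≡ arc u → t ≡ u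
  arc-injective {t} {u} eq = simple t u (cong tail eq)

  _∈Γ : Arc → Set
  a ∈Γ = ∃ λ t → arc t ≡ a

  arc-unique : ∀ {a t u} → arc t ≡ a → arc u ≡ a → t ≡ u
  arc-unique eq₁ eq₂ = arc-injective (trans eq₁ (sym eq₂))

  multiplicity : Arc → ℕ
  multiplicity a = sum (λ t → if ⌊ arc t ≟A a ⌋ then 1 else 0)

  multiplicity-∈ : ∀ {a} → a ∈Γ → multiplicity a ≡ 1
  multiplicity-∈ {a} (t , eq) = sum-if-unique (λ t → arc t ≟A a) arc-unique (λ _ → 1) eq

  multiplicity-∉ : ∀ {a} → ¬ a ∈Γ → multiplicity a ≡ 0
  multiplicity-∉ {a} a∉Γ = sum-if-none (λ t → arc t ≟A a) arc-unique (λ _ → 1) a∉Γ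

  rowWeight : (Fin m → ℕ) → Arc → ℕ
  rowWeight g (rowArc i) = g i
  rowWeight g (fwd _)    = 0
  rowWeight g (rev _)    = 0

  rowWeight-as-sum : ∀ g a → rowWeight g a ≡ sum (λ i → if ⌊ a ≟A rowArc i ⌋ then g i else 0)
  rowWeight-as-sum g (rowArc i) = sym (sum-if-unique (λ i′ → rowArc i ≟A rowArc i′) (λ { refl refl → refl }) g refl)
  rowWeight-as-sum g (fwd j)    = sym (sum-zero (λ i → if ⌊ fwd j ≟A rowArc i ⌋ then g i else 0) λ _ → refl)
  rowWeight-as-sum g (rev j)    = sym (sum-zero (λ i → if ⌊ rev j ≟A rowArc i ⌋ then g i else 0) λ _ → refl)

  sum-rowsOf : ∀ g → sumFin (λ i → if rowsOf Γ i then g i else 0) ≡ sum (λ t → rowWeight g (arc t))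
  sum-rowsOf g = begin
    sumFin (λ i → if rowsOf Γ i then g i else 0)   ≡⟨ sumFin≡sum (λ i → if rowsOf Γ i then g i else 0) ⟩
    sum (λ i → if rowsOf Γ i then g i else 0)      ≡⟨ sum-cong-≗ (λ i → sum-if-any (_≟A rowArc i ∘ arc) arc-unique (g i)) ⟨
    sum (λ i → sum (λ t → incidence t i))          ≡⟨ ∑-comm (λ i t → incidence t i) ⟩
    sum (λ t → sum (λ i → incidence t i))          ≡⟨ sum-cong-≗ (λ t → rowWeight-as-sum g (arc t)) ⟨
    sum (λ t → rowWeight g (arc t))                ∎
    where
    open ≡-Reasoning
    incidence : Fin (suc size) → Fin m → ℕ
    incidence t i = if ⌊ arc t ≟A rowArc i ⌋ then g i else 0

  card-rowsOf : card (rowsOf Γ) ≡ rowArcCount Γ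
  card-rowsOf = begin
    card (rowsOf Γ)                          ≡⟨ sum-rowsOf (λ _ → 1) ⟩
    sum (λ t → rowWeight (λ _ → 1) (arc t))  ≡⟨ sum-cong-≗ (λ t → unitWeight (arc t)) ⟩
    sum (λ t → isRowArc Γ (arc t))           ≡⟨ sumFin≡sum (λ t → isRowArc Γ (arc t)) ⟨
    rowArcCount Γ                            ∎
    where
    open ≡-Reasoning
    unitWeight : ∀ a → rowWeight (λ _ → 1) a ≡ isRowArc Γ a
    unitWeight (rowArc _) = refl
    unitWeight (fwd _)    = refl
    unitWeight (rev _)    = refl

  next : Fin (suc size) → Fin (suc size)
  next t = fromℕ< (m%n<n (suc (toℕ t)) (suc size))

  toℕ-next : ∀ t → toℕ (next t) ≡ suc (toℕ t) % suc size
  toℕ-next t = toℕ-fromℕ< (m%n<n (suc (toℕ t)) (suc size))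

  next-unique : ∀ {t u} → head (arc t) ≡ tail (arc u) → next t ≡ u
  next-unique {t} {u} eq = simple (next t) u (trans (sym (closed t (next t) (toℕ-next t))) eq)

  sum-head≡sum-tail : ∀ (g : ℕ → ℕ) → sum (λ t → g (head (arc t))) ≡ sum (λ t → g (tail (arc t)))
  sum-head≡sum-tail g = begin
    sum (λ t → g (head (arc t)))
      ≡⟨ sum-init-last (λ t → g (head (arc t))) ⟩
    sum (λ i → g (head (arc (inject₁ i)))) + g (head (arc (fromℕ size)))
      ≡⟨ cong₂ _+_ (sum-cong-≗ (cong g ∘ into-suc)) (cong g wrap) ⟩
    sum (λ i → g (tail (arc (Fin.suc i)))) + g (tail (arc 0F))
      ≡⟨ +-comm (sum (λ i → g (tail (arc (Fin.suc i))))) _ ⟩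
    sum (λ t → g (tail (arc t)))
      ∎
    where
    open ≡-Reasoning
    into-suc : ∀ i → head (arc (inject₁ i)) ≡ tail (arc (Fin.suc i))
    into-suc i = closed (inject₁ i) (Fin.suc i)
      (sym (trans (cong (λ x → suc x % suc size) (toℕ-inject₁ i)) (m<n⇒m%n≡m (s≤s (toℕ<n i)))))
    wrap : head (arc (fromℕ size)) ≡ tail (arc 0F)
    wrap = closed (fromℕ size) 0F
      (sym (trans (cong (λ x → suc x % suc size) (toℕ-fromℕ size)) (n%n≡0 (suc size))))

  length⁺ length⁻ : Arc → ℕ
  length⁺ (rowArc i) = Circular.k A i
  length⁺ (fwd _)    = 1
  length⁺ (rev _)    = 0
  length⁻ (rowArc _) = 0
  length⁻ (fwd _)    = 0
  length⁻ (rev _)    = 1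

  arcLength-split : ∀ a → arcLength a ℤ.+ + length⁻ a ≡ + length⁺ a
  arcLength-split (rowArc i) = ℤP.+-identityʳ _
  arcLength-split (fwd _)    = refl
  arcLength-split (rev _)    = refl

  module _ (j : Fin n) where
    open Rotation n (toℕ j) (toℕ<n j)

    crossings : Arc → ℕ
    crossings (rowArc i) = entry i j
    crossings (fwd j′)   = if ⌊ fwd j′ ≟A fwd j ⌋ then 1 else 0
    crossings (rev _)    = 0

    crossings-split : ∀ a → crossings a ≡ rowWeight (λ i → entry i j) a + (if ⌊ a ≟A fwd j ⌋ then 1 else 0)
    crossings-split (rowArc i) = sym (+-identityʳ (entry i j))
    crossings-split (fwd _)    = refl
    crossings-split (rev _)    = refl

    arc-balance : ∀ a → (if ⌊ a ≟A rev j ⌋ then 1 else 0) * n + (length⁺ a + ψ (tail a))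
                      ≡ length⁻ a + (crossings a * n + ψ (head a))
    arc-balance (rowArc i) = interval-crossing (toℕ (Circular.ℓ A i)) (Circular.k A i) (toℕ<n (Circular.ℓ A i))
                               (≤-trans (Circular.k≤n-1 A i) (m∸n≤m n 1))
    arc-balance (fwd j′) with fwd j′ ≟A fwd j
    ... | yes refl = unit-crossing-≡
    ... | no j′≢j  = unit-crossing-≢ (toℕ j′) (toℕ<n j′) (j′≢j ∘ cong fwd ∘ toℕ-injective)
    arc-balance (rev j′) with rev j′ ≟A rev j
    ... | yes refl = sym unit-crossing-≡
    ... | no j′≢j  = sym (unit-crossing-≢ (toℕ j′) (toℕ<n j′) (j′≢j ∘ cong rev ∘ toℕ-injective))

  ΓIneq-form : ∀ α p {{_ : NonZero p}} → ¬ p ∣ α * rowArcCount Γ →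
    let s = rowArcCount Γ
        r = α * s ∸ p * (α * s / p)
        I = ΓIneq Γ α p
    in (∀ j → (Otimes Γ j → Ineq.coef I j ≡ suc r) × (¬ Otimes Γ j → Ineq.coef I j ≡ r))
       × Ineq.rhs I ≡ r * ceilDiv (α * s) p
  ΓIneq-form α p p∤αs =
    (λ j → (λ ⊗j → cong₂ _+_ (pMinus≡ j (multiplicity-∈ ⊗j)) r≡)
         , (λ ¬⊗j → cong₂ _+_ (pMinus≡ j (multiplicity-∉ ¬⊗j)) r≡))
    , cong₂ _*_ r≡ (sym (ceilDiv-∤ (α * rowArcCount Γ) p p∤αs))
    where
    r≡ : α * rowArcCount Γ ∸ (α * rowArcCount Γ / p) * p ≡ α * rowArcCount Γ ∸ p * (α * rowArcCount Γ / p)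
    r≡ = cong (α * rowArcCount Γ ∸_) (*-comm (α * rowArcCount Γ / p) p)
    pMinus≡ : ∀ j {c} → multiplicity (rev j) ≡ c → pMinus Γ j ≡ c
    pMinus≡ j = trans (sumFin≡sum (λ t → if ⌊ arc t ≟A rev j ⌋ then 1 else 0))

  module _ (p : ℕ) (winding : HasWinding Γ (+ p)) where

    total-length : sum (λ t → length⁺ (arc t)) ≡ p * n + sum (λ t → length⁻ (arc t))
    total-length = ℤP.+-injective (begin
      + sum L⁺                                          ≡⟨ pos-sum L⁺ ⟩
      ℤΣ.sum (λ t → + L⁺ t)                             ≡⟨ ℤΣ.sum-cong-≗ (λ t → arcLength-split (arc t)) ⟨
      ℤΣ.sum (λ t → len t ℤ.+ + L⁻ t)                   ≡⟨ ℤΣ.∑-distrib-+ len (λ t → + L⁻ t) ⟩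
      ℤΣ.sum len ℤ.+ ℤΣ.sum (λ t → + L⁻ t)              ≡⟨ cong₂ ℤ._+_ (trans (sym (sumFinℤ≡sum len)) winding)
                                                                       (sym (pos-sum L⁻)) ⟩
      + p ℤ.* + n ℤ.+ + sum L⁻                          ≡⟨ cong (ℤ._+ + sum L⁻) (ℤP.pos-* p n) ⟨
      + (p * n) ℤ.+ + sum L⁻                            ≡⟨ ℤP.pos-+ (p * n) (sum L⁻) ⟨
      + (p * n + sum L⁻)                                ∎)
      where
      open ≡-Reasoning
      L⁺ L⁻ : Fin (suc size) → ℕ
      L⁺ t = length⁺ (arc t)
      L⁻ t = length⁻ (arc t)
      len : Fin (suc size) → ℤ
      len t = arcLength (arc t)

    column-balance : ∀ j → p + multiplicity (rev j) ≡ colSum (rowsOf Γ) j + multiplicity (fwd j)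
    column-balance j = begin
      p + sum isRev                         ≡⟨ *-cancelʳ-≡ (p + sum isRev) (sum cross) n
                                                 (cancel-common (sum isRev) p (sum cross) (sum L⁻) (sum ψtail) summed) ⟩
      sum cross                             ≡⟨ sum-cong-≗ (λ t → crossings-split j (arc t)) ⟩
      sum (λ t → rowCross t + isFwd t)      ≡⟨ ∑-distrib-+ rowCross isFwd ⟩
      sum rowCross + sum isFwd              ≡⟨ cong (_+ sum isFwd) (sum-rowsOf (λ i → entry i j)) ⟨
      colSum (rowsOf Γ) j + sum isFwd       ∎
      where
      open ≡-Reasoning
      open Rotation n (toℕ j) (toℕ<n j) using (ψ)
      isRev isFwd rowCross cross L⁺ L⁻ ψtail ψhead : Fin (suc size) → ℕ
      isRev t    = if ⌊ arc t ≟A rev j ⌋ then 1 else 0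
      isFwd t    = if ⌊ arc t ≟A fwd j ⌋ then 1 else 0
      rowCross t = rowWeight (λ i → entry i j) (arc t)
      cross t    = crossings j (arc t)
      L⁺ t       = length⁺ (arc t)
      L⁻ t       = length⁻ (arc t)
      ψtail t    = ψ (tail (arc t))
      ψhead t    = ψ (head (arc t))
      summed : sum isRev * n + (p * n + sum L⁻ + sum ψtail) ≡ sum L⁻ + (sum cross * n + sum ψtail)
      summed = begin
        sum isRev * n + (p * n + sum L⁻ + sum ψtail)
          ≡⟨ cong (λ x → sum isRev * n + (x + sum ψtail)) total-length ⟨
        sum isRev * n + (sum L⁺ + sum ψtail)
          ≡⟨ cong₂ _+_ (*-distribʳ-sum n isRev) (sym (∑-distrib-+ L⁺ ψtail)) ⟩
        sum (λ t → isRev t * n) + sum (λ t → L⁺ t + ψtail t)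
          ≡⟨ ∑-distrib-+ (λ t → isRev t * n) (λ t → L⁺ t + ψtail t) ⟨
        sum (λ t → isRev t * n + (L⁺ t + ψtail t))
          ≡⟨ sum-cong-≗ (λ t → arc-balance j (arc t)) ⟩
        sum (λ t → L⁻ t + (cross t * n + ψhead t))
          ≡⟨ ∑-distrib-+ L⁻ (λ t → cross t * n + ψhead t) ⟩
        sum L⁻ + sum (λ t → cross t * n + ψhead t)
          ≡⟨ cong (λ x → sum L⁻ + x) (∑-distrib-+ (λ t → cross t * n) ψhead) ⟩
        sum L⁻ + (sum (λ t → cross t * n) + sum ψhead)
          ≡⟨ cong₂ (λ x y → sum L⁻ + (x + y)) (*-distribʳ-sum n cross) (sym (sum-head≡sum-tail ψ)) ⟨
        sum L⁻ + (sum cross * n + sum ψtail) ∎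

    fwd-rev-exclusive : {{_ : NonZero p}} → ∀ {j} → fwd j ∈Γ → ¬ rev j ∈Γ
    fwd-rev-exclusive {j} (t , t↦fwd) (u , u↦rev) = <-irrefl (sym p≡0) (>-nonZero⁻¹ p)
      where
      next-t : next t ≡ u
      next-t = next-unique (trans (cong head t↦fwd) (sym (cong tail u↦rev)))
      next-u : next u ≡ t
      next-u = next-unique (trans (cong head u↦rev) (sym (cong tail t↦fwd)))
      t≢u : t ≢ u
      t≢u refl with trans (sym t↦fwd) u↦rev
      ... | ()
      two-arcs : suc size ≡ 2
      two-arcs = successor-swap⇒2 (toℕ<n t) (toℕ<n u)
        (trans (cong toℕ (sym next-t)) (toℕ-next t))
        (trans (cong toℕ (sym next-u)) (toℕ-next u))
        (t≢u ∘ toℕ-injective)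
      on-pair : ∀ (L : Arc → ℕ) → sum (λ t → L (arc t)) ≡ L (fwd j) + L (rev j)
      on-pair L = trans (sum-pair two-arcs (L ∘ arc) t≢u) (cong₂ _+_ (cong L t↦fwd) (cong L u↦rev))
      p≡0 : p ≡ 0
      p≡0 = m*n≡0⇒m≡0 p n (+-cancelʳ-≡ 1 (p * n) 0 (sym (begin
        1                                    ≡⟨ on-pair length⁺ ⟨
        sum (λ t → length⁺ (arc t))          ≡⟨ total-length ⟩
        p * n + sum (λ t → length⁻ (arc t))  ≡⟨ cong (λ x → p * n + x) (on-pair length⁻) ⟩
        p * n + 1                            ∎)))
        where open ≡-Reasoning

    colSum-⊗ : {{_ : NonZero p}} → ∀ {j} → Otimes Γ j → colSum (rowsOf Γ) j ≡ suc p
    colSum-⊗ {j} rev∈Γ = sym (begin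
      suc p                                       ≡⟨ +-comm 1 p ⟩
      p + 1                                       ≡⟨ cong (λ x → p + x) (multiplicity-∈ rev∈Γ) ⟨
      p + multiplicity (rev j)                    ≡⟨ column-balance j ⟩
      colSum (rowsOf Γ) j + multiplicity (fwd j)  ≡⟨ cong (λ x → colSum (rowsOf Γ) j + x) (multiplicity-∉ fwd∉Γ) ⟩
      colSum (rowsOf Γ) j + 0                     ≡⟨ +-identityʳ _ ⟩
      colSum (rowsOf Γ) j                         ∎)
      where
      open ≡-Reasoning
      fwd∉Γ : ¬ fwd j ∈Γ
      fwd∉Γ fwd∈Γ = fwd-rev-exclusive fwd∈Γ rev∈Γ

    colSum-¬⊗ : ∀ {j} → ¬ Otimes Γ j → colSum (rowsOf Γ) j ≤ p
    colSum-¬⊗ {j} rev∉Γ = m+n≤o⇒m≤o (colSum (rowsOf Γ) j) (≤-reflexive (begin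
      colSum (rowsOf Γ) j + multiplicity (fwd j)  ≡⟨ column-balance j ⟨
      p + multiplicity (rev j)                    ≡⟨ cong (λ x → p + x) (multiplicity-∉ rev∉Γ) ⟩
      p + 0                                       ≡⟨ +-identityʳ p ⟩
      p                                           ∎))
      where open ≡-Reasoning

    maxColSum : {{_ : NonZero p}} → ∃ (Otimes Γ) → maxFin (colSum (rowsOf Γ)) ≡ suc p
    maxColSum (j₀ , ⊗j₀) = maxFin-attained (colSum (rowsOf Γ)) j₀ (colSum-⊗ ⊗j₀) bound
      where
      bound : ∀ j → colSum (rowsOf Γ) j ≤ suc p
      bound j with any? (λ t → arc t ≟A rev j)
      ... | yes ⊗j = ≤-reflexive (colSum-⊗ ⊗j)
      ... | no ¬⊗j = m≤n⇒m≤1+n (colSum-¬⊗ ¬⊗j)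

    ΓIneq≡rfi : {{_ : NonZero p}} → ¬ p ∣ 1 * rowArcCount Γ → 2 ≤ p → p ≤ 1 * rowArcCount Γ ∸ 1 → ∃ (Otimes Γ) →
      Σ (NonZero (pInduced (rowsOf Γ))) λ nzq →
        ValidRFI (rowsOf Γ) (pInduced (rowsOf Γ)) × SameIneq (ΓIneq Γ 1 p) (rfi (rowsOf Γ) (pInduced (rowsOf Γ)) {{nzq}})
    ΓIneq≡rfi {{p≢0}} p∤s 2≤p p≤s-1 ⊗≠∅ = subst RFIof (sym pInduced≡p) (p≢0 , valid , coef≡ , rhs≡)
      where
      F = rowsOf Γ
      s = rowArcCount Γ
      RFIof : ℕ → Set
      RFIof q = Σ (NonZero q) λ nzq → ValidRFI F q × SameIneq (ΓIneq Γ 1 p) (rfi F q {{nzq}})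
      pInduced≡p : pInduced F ≡ p
      pInduced≡p = cong (_∸ 1) (maxColSum ⊗≠∅)
      card≡ : card F ≡ 1 * s
      card≡ = trans card-rowsOf (sym (*-identityˡ s))
      valid : ValidRFI F p
      valid = subst (λ c → 2 ≤ c × 1 ≤ p × p ≤ c ∸ 1 × ¬ p ∣ c) (sym card≡)
                (≤-trans 2≤p (≤-trans p≤s-1 (m∸n≤m (1 * s) 1)) , >-nonZero⁻¹ p , p≤s-1 , p∤s)
      r≡ : 1 * s ∸ p * (1 * s / p) ≡ card F ∸ p * (card F / p)
      r≡ = cong (λ c → c ∸ p * (c / p)) (sym card≡)
      form = ΓIneq-form 1 p p∤s
      coef≡ : ∀ j → Ineq.coef (ΓIneq Γ 1 p) j ≡ Ineq.coef (rfi F p) j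
      coef≡ j with any? (λ t → arc t ≟A rev j)
      ... | yes ⊗j = trans (proj₁ (proj₁ form j) ⊗j) (trans (cong suc r≡) (sym (rfi-coef-O A F p (colSum-⊗ ⊗j))))
      ... | no ¬⊗j = trans (proj₂ (proj₁ form j) ¬⊗j) (trans r≡ (sym (rfi-coef-I A F p (colSum-¬⊗ ¬⊗j))))
      rhs≡ : Ineq.rhs (ΓIneq Γ 1 p) ≡ Ineq.rhs (rfi F p)
      rhs≡ = trans (proj₂ form) (cong₂ _*_ r≡ (cong (λ c → ceilDiv c p) (sym card≡)))

theorem6p2 : (m n : ℕ) {{_ : NonZero n}} (A : Circular m n) →
  Setup.NoDominatingRows m n A →
  (α : ℕ) (Γ : Setup.Circuit m n A) (p : ℕ) {{_ : NonZero p}} →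
  Setup.HasWinding m n A Γ (+ p) →
  ¬ (p ∣ α * Setup.rowArcCount m n A Γ) →
  2 ≤ p →
  p ≤ α * Setup.rowArcCount m n A Γ ∸ 1 →
  let s = Setup.rowArcCount m n A Γ
      r = α * s ∸ p * (α * s / p)
      I = Setup.ΓIneq m n A Γ α p
  in ((∀ (j : Fin n) → (Setup.Otimes m n A Γ j → Ineq.coef I j ≡ suc r)
                      × (¬ Setup.Otimes m n A Γ j → Ineq.coef I j ≡ r))
      × Ineq.rhs I ≡ r * ceilDiv (α * s) p)
     × (α ≡ 1 → ∃ (Setup.Otimes m n A Γ) →
        let F = Setup.rowsOf m n A Γ
            q = Setup.pInduced m n A F
        in Σ (NonZero q) λ nzq →
             Setup.ValidRFI m n A F q
             × SameIneq I (Setup.rfi m n A F q {{nzq}}))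
theorem6p2 m n A _ α Γ p winding p∤αs 2≤p p≤αs∸1 =
  ΓIneq-form α p p∤αs , λ { refl → ΓIneq≡rfi p winding p∤αs 2≤p p≤αs∸1 }
  where open CircuitBalance Γ
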